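{- Define $\beta_n\in\mathbb{Z}/2[t]$ for odd $n>0$ by $\beta_1=t$, $\beta_3=t^3$, $\beta_5=t^5$, $\beta_7=t^7+t^3$ and $\beta_{n+8}=t^8\beta_n+t^2\beta_{n+2}$. Then for every odd $n>0$, $\beta_n$ equals $t^n$ plus a sum of monomials preceding $t^n$.
   Context: Let $g:\mathbb{N}\to\mathbb{N}$ be defined by $g(0)=0$, $g(2n)=4g(n)$, $g(2n+1)=g(2n)+1$. For $a,b\in\mathbb{N}$, $[a,b]$ denotes $t^{1+2g(a)+4g(b)}$; every $t^k$ with $k$ odd positive is uniquely of this form. Say $[c,d]$ precedes $[a,b]$ if $c+d<a+b$, or $c+d=a+b$ and $d<b$. "A sum of monomials" means a finite (possibly empty) sum of distinct monomials. -}

module Defs where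

open import Data.Nat using (ℕ; zero; suc; _+_; _*_; _<_; _/_; _%_)
open import Data.Bool using (Bool; true; false; _xor_)
open import Data.List using (List; []; _∷_; replicate; _++_)
open import Data.Product using (_×_; _,_; proj₁; ∃-syntax)
open import Data.Sum using (_⊎_)
open import Relation.Binary.PropositionalEquality using (_≡_)

-- The function g : ℕ → ℕ with g 0 = 0, g (2n) = 4 g n, g (2n+1) = g (2n) + 1.
-- Computed by recursion on the binary digits of n, with fuel (n steps
-- always suffice, since each step halves the argument).

gAux : ℕ → ℕ → ℕ
gAux zero    n = 0
gAux (suc f) n = 4 * gAux f (n / 2) + n % 2

g : ℕ → ℕ
g n = gAux n n

-- [a,b] denotes t^(1 + 2 g(a) + 4 g(b)); this is its exponent.
bracketExp : ℕ → ℕ → ℕ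
bracketExp a b = 1 + 2 * g a + 4 * g b

PrecedesPair : ℕ → ℕ → ℕ → ℕ → Set
PrecedesPair c d a b = (c + d < a + b) ⊎ ((c + d ≡ a + b) × (d < b))

Precedes : ℕ → ℕ → Set
Precedes e k = ∃[ a ] ∃[ b ] ∃[ c ] ∃[ d ]
  ((k ≡ bracketExp a b) × (e ≡ bracketExp c d) × PrecedesPair c d a b)

-- Polynomials over ℤ/2: coefficient lists, index i = coefficient of t^i.

Poly : Set
Poly = List Bool

_⊕_ : Poly → Poly → Poly
[]       ⊕ q        = q
(x ∷ p)  ⊕ []       = x ∷ p
(x ∷ p)  ⊕ (y ∷ q)  = (x xor y) ∷ (p ⊕ q)

shift : ℕ → Poly → Poly
shift m p = replicate m false ++ p

mono : ℕ → Poly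
mono m = shift m (true ∷ [])

coeff : Poly → ℕ → Bool
coeff []      _       = false
coeff (x ∷ p) zero    = x
coeff (x ∷ p) (suc i) = coeff p i

-- β_{2k+1}: β₁ = t, β₃ = t³, β₅ = t⁵, β₇ = t⁷ + t³,
-- β_{n+8} = t⁸ β_n + t² β_{n+2}.
-- betaQuad k = (β_{2k+1}, β_{2k+3}, β_{2k+5}, β_{2k+7}).

betaQuad : ℕ → Poly × Poly × Poly × Poly
betaQuad zero = mono 1 , mono 3 , mono 5 , (mono 7 ⊕ mono 3)
betaQuad (suc k) with betaQuad k
... | (p0 , p1 , p2 , p3) = p1 , p2 , p3 , (shift 8 p0 ⊕ shift 2 p1)

-- betaOdd k = β_{2k+1}
betaOdd : ℕ → Poly
betaOdd k = proj₁ (betaQuad k)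

-- The coefficient of t^(2j+1) in β_(2k+1) vanishes unless k = 3m + r and j = m + r, and it is
-- then C(m + ⌊r/4⌋, m) mod 2: in these coordinates the recurrence for β becomes Pascal's rule.
-- By Lucas' theorem it is 1 exactly when m and ⌊r/4⌋ have no binary digit in common; the
-- leading monomial t^(2k+1) is the case m = 0.
-- Writing t^(2n+1) = [a, b], where a and b collect the binary digits of n at even and at odd
-- positions, [a, b] precedes [a′, b′] as soon as a + b ≤ a′ + b′ and 2a + 3b < 2a′ + 3b′. For
-- n = m + r and n′ = 3m + r with m ≥ 1, both inequalities are proved digit by digit in base 4:
-- an automaton reads m and ⌊r/4⌋, tracking the carries of the two additions, and an invariant
-- with explicit slack is checked to be preserved by a finite computation over its states.

module Submission where

open import Defs
open import Data.Bool using (Bool; true; false; _xor_; _∧_; _∨_; not; T; if_then_else_)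
open import Data.Bool.Properties using (∧-distribʳ-xor; xor-identityʳ; ¬-not; T-∧; T-≡)
open import Data.Empty using (⊥; ⊥-elim)
open import Data.List using ([]; _∷_)
open import Data.Nat
open import Data.Nat.DivMod
open import Data.Nat.Divisibility using (divides-refl)
open import Data.Nat.Properties
open import Data.Nat.Tactic.RingSolver using (solve-∀)
open import Data.Unit using (tt)
open import Data.Product using (_×_; _,_; proj₁; proj₂; ∃₂; ∃-syntax)
open import Data.Sum using (_⊎_; inj₁; inj₂)
open import Function.Bundles using (Equivalence)
open import Relation.Binary.PropositionalEquality
open ≡-Reasoning

-- Base-4 digits

[d*q+r]/d≡q : ∀ d q r .{{_ : NonZero d}} → r < d → (d * q + r) / d ≡ q
[d*q+r]/d≡q d q r r<d = begin
  (d * q + r) / d     ≡⟨ /-congˡ (trans (+-comm (d * q) r) (cong (r +_) (*-comm d q))) ⟩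
  (r + q * d) / d     ≡⟨ +-distrib-/-∣ʳ r (divides-refl q) ⟩
  r / d + q * d / d   ≡⟨ cong₂ _+_ (m<n⇒m/n≡0 r<d) (m*n/n≡m q d) ⟩
  q                   ∎

[d*q+r]%d≡r : ∀ d q r .{{_ : NonZero d}} → r < d → (d * q + r) % d ≡ r
[d*q+r]%d≡r d q r r<d = begin
  (d * q + r) % d  ≡⟨ %-congˡ (trans (+-comm (d * q) r) (cong (r +_) (*-comm d q))) ⟩
  (r + q * d) % d  ≡⟨ [m+kn]%n≡m%n r q d ⟩
  r % d            ≡⟨ m<n⇒m%n≡m r<d ⟩
  r                ∎

m≡d*[m/d]+m%d : ∀ m d .{{_ : NonZero d}} → m ≡ d * (m / d) + m % d
m≡d*[m/d]+m%d m d = trans (m≡m%n+[m/n]*n m d) (trans (+-comm (m % d) _) (cong (_+ m % d) (*-comm (m / d) d)))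

m≤1+n⇒m/d≤n : ∀ m n d .{{_ : NonZero d}} → 1 < d → m ≤ suc n → m / d ≤ n
m≤1+n⇒m/d≤n zero    n d _   _   = ≤-trans (≤-reflexive (0/n≡0 d)) z≤n
m≤1+n⇒m/d≤n (suc m) n d 1<d m≤n = ≤-pred (≤-trans (m/n<m (suc m) d 1<d) m≤n)

base4-induction₂ : (P : ℕ → ℕ → Set) → P 0 0 →
                   (∀ q a p b → a < 4 → b < 4 → P q p → P (4 * q + a) (4 * p + b)) →
                   ∀ x y → P x y
base4-induction₂ P base step x y = go (x + y) x y (m≤m+n x y) (m≤n+m y x)
  where
  go : ∀ f x y → x ≤ f → y ≤ f → P x y
  go zero    zero    zero    _   _   = base
  go zero    (suc x) y       ()  _
  go zero    zero    (suc y) _   ()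
  go (suc f) x       y       x≤f y≤f =
    subst₂ P (sym (m≡d*[m/d]+m%d x 4)) (sym (m≡d*[m/d]+m%d y 4))
      (step (x / 4) (x % 4) (y / 4) (y % 4) (m%n<n x 4) (m%n<n y 4)
        (go f (x / 4) (y / 4) (m≤1+n⇒m/d≤n x f 4 (s≤s (s≤s z≤n)) x≤f) (m≤1+n⇒m/d≤n y f 4 (s≤s (s≤s z≤n)) y≤f)))

base4-induction : (P : ℕ → Set) → P 0 → (∀ q δ → δ < 4 → P q → P (4 * q + δ)) → ∀ n → P n
base4-induction P base step n = base4-induction₂ (λ x _ → P x) base (λ q a _ _ a<4 _ → step q a a<4) n 0

-- digitSumAux w f x y = Σᵢ 2ⁱ w xᵢ yᵢ over the base-4 digits xᵢ, yᵢ, once the fuel f is at least x and y.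
digitSumAux : (ℕ → ℕ → ℕ) → ℕ → ℕ → ℕ → ℕ
digitSumAux w zero    x y = 0
digitSumAux w (suc f) x y = 2 * digitSumAux w f (x / 4) (y / 4) + w (x % 4) (y % 4)

digitSum : (ℕ → ℕ → ℕ) → ℕ → ℕ → ℕ
digitSum w x y = digitSumAux w (x + y) x y

module _ (w : ℕ → ℕ → ℕ) (w00≡0 : w 0 0 ≡ 0) where

  digitSumAux-00 : ∀ f → digitSumAux w f 0 0 ≡ 0
  digitSumAux-00 zero    = refl
  digitSumAux-00 (suc f) rewrite digitSumAux-00 f | w00≡0 = refl

  digitSumAux-fuel : ∀ f h x y → x ≤ f → y ≤ f → x ≤ h → y ≤ h → digitSumAux w f x y ≡ digitSumAux w h x y
  digitSumAux-fuel zero    h       zero zero _   _   _   _   = sym (digitSumAux-00 h)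
  digitSumAux-fuel (suc f) zero    zero zero _   _   _   _   = digitSumAux-00 (suc f)
  digitSumAux-fuel (suc f) (suc h) x    y    x≤f y≤f x≤h y≤h =
    cong (λ t → 2 * t + w (x % 4) (y % 4))
      (digitSumAux-fuel f h (x / 4) (y / 4) (quot x≤f) (quot y≤f) (quot x≤h) (quot y≤h))
    where
    quot : ∀ {n f} → n ≤ suc f → n / 4 ≤ f
    quot {n} {f} = m≤1+n⇒m/d≤n n f 4 (s≤s (s≤s z≤n))

  digitSum-digits : ∀ q a p b → a < 4 → b < 4 → digitSum w (4 * q + a) (4 * p + b) ≡ 2 * digitSum w q p + w a b
  digitSum-digits q a p b a<4 b<4 = begin
    digitSumAux w (x + y) x y
      ≡⟨ digitSumAux-fuel (x + y) (suc (x + y)) x y x≤ y≤ (m≤n⇒m≤1+n x≤) (m≤n⇒m≤1+n y≤) ⟩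
    2 * digitSumAux w (x + y) (x / 4) (y / 4) + w (x % 4) (y % 4)
      ≡⟨ cong₂ (λ u v → 2 * digitSumAux w (x + y) u v + w (x % 4) (y % 4)) ([d*q+r]/d≡q 4 q a a<4) ([d*q+r]/d≡q 4 p b b<4) ⟩
    2 * digitSumAux w (x + y) q p + w (x % 4) (y % 4)
      ≡⟨ cong₂ (λ u v → 2 * digitSumAux w (x + y) q p + w u v) ([d*q+r]%d≡r 4 q a a<4) ([d*q+r]%d≡r 4 p b b<4) ⟩
    2 * digitSumAux w (x + y) q p + w a b
      ≡⟨ cong (λ t → 2 * t + w a b) (digitSumAux-fuel (x + y) (q + p) q p q≤ p≤ (m≤m+n q p) (m≤n+m p q)) ⟩
    2 * digitSum w q p + w a b
      ∎
    where
    x = 4 * q + a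
    y = 4 * p + b
    x≤ : x ≤ x + y
    x≤ = m≤m+n x y
    y≤ : y ≤ x + y
    y≤ = m≤n+m y x
    q≤ : q ≤ x + y
    q≤ = ≤-trans (m≤n*m q 4) (≤-trans (m≤m+n (4 * q) a) x≤)
    p≤ : p ≤ x + y
    p≤ = ≤-trans (m≤n*m p 4) (≤-trans (m≤m+n (4 * p) b) y≤)

-- Exponents as brackets

gAux-0 : ∀ f → gAux f 0 ≡ 0
gAux-0 zero    = refl
gAux-0 (suc f) rewrite gAux-0 f = refl

gAux-fuel : ∀ f h n → n ≤ f → n ≤ h → gAux f n ≡ gAux h n
gAux-fuel zero    h       zero    _   _   = sym (gAux-0 h)
gAux-fuel (suc f) zero    zero    _   _   = gAux-0 (suc f)
gAux-fuel (suc f) (suc h) n       n≤f n≤h =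
  cong (λ t → 4 * t + n % 2) (gAux-fuel f h (n / 2) (m≤1+n⇒m/d≤n n f 2 ≤-refl n≤f) (m≤1+n⇒m/d≤n n h 2 ≤-refl n≤h))

g[2x+α]≡4gx+α : ∀ x α → α < 2 → g (2 * x + α) ≡ 4 * g x + α
g[2x+α]≡4gx+α x α α<2 = begin
  gAux n n                    ≡⟨ gAux-fuel n (suc n) n ≤-refl (n≤1+n n) ⟩
  4 * gAux n (n / 2) + n % 2  ≡⟨ cong₂ (λ u v → 4 * gAux n u + v) ([d*q+r]/d≡q 2 x α α<2) ([d*q+r]%d≡r 2 x α α<2) ⟩
  4 * gAux n x + α            ≡⟨ cong (λ t → 4 * t + α) (gAux-fuel n x x x≤n ≤-refl) ⟩
  4 * g x + α                 ∎
  where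
  n = 2 * x + α
  x≤n : x ≤ n
  x≤n = ≤-trans (m≤m+n x (x + 0)) (m≤m+n (2 * x) α)

digitSum₁ : (ℕ → ℕ) → ℕ → ℕ
digitSum₁ w n = digitSum (λ a _ → w a) n 0

digitSum₁-digit : ∀ w → w 0 ≡ 0 → ∀ q δ → δ < 4 → digitSum₁ w (4 * q + δ) ≡ 2 * digitSum₁ w q + w δ
digitSum₁-digit w w0≡0 q δ δ<4 = digitSum-digits (λ a _ → w a) w0≡0 q δ 0 0 δ<4 (s≤s z≤n)

-- They collect the binary digits of n at even and at odd positions, so t^(2n+1) = [evenBits n, oddBits n].
evenBits oddBits : ℕ → ℕ
evenBits = digitSum₁ (_% 2)
oddBits  = digitSum₁ (_/ 2)

g-evenBits+2g-oddBits : ∀ n → g (evenBits n) + 2 * g (oddBits n) ≡ n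
g-evenBits+2g-oddBits = base4-induction (λ n → g (evenBits n) + 2 * g (oddBits n) ≡ n) refl step
  where
  step : ∀ q δ → δ < 4 → g (evenBits q) + 2 * g (oddBits q) ≡ q →
         g (evenBits (4 * q + δ)) + 2 * g (oddBits (4 * q + δ)) ≡ 4 * q + δ
  step q δ δ<4 ih = begin
    g (evenBits (4 * q + δ)) + 2 * g (oddBits (4 * q + δ))
      ≡⟨ cong₂ (λ u v → g u + 2 * g v) (digitSum₁-digit (_% 2) refl q δ δ<4) (digitSum₁-digit (_/ 2) refl q δ δ<4) ⟩
    g (2 * evenBits q + δ % 2) + 2 * g (2 * oddBits q + δ / 2)
      ≡⟨ cong₂ (λ u v → u + 2 * v) (g[2x+α]≡4gx+α (evenBits q) (δ % 2) (m%n<n δ 2))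
                                    (g[2x+α]≡4gx+α (oddBits q) (δ / 2) (m<n*o⇒m/o<n {δ} {2} {2} δ<4)) ⟩
    4 * g (evenBits q) + δ % 2 + 2 * (4 * g (oddBits q) + δ / 2)
      ≡⟨ regroup (g (evenBits q)) (g (oddBits q)) (δ % 2) (δ / 2) ⟩
    4 * (g (evenBits q) + 2 * g (oddBits q)) + (2 * (δ / 2) + δ % 2)
      ≡⟨ cong₂ (λ u v → 4 * u + v) ih (sym (m≡d*[m/d]+m%d δ 2)) ⟩
    4 * q + δ
      ∎
    where
    regroup : ∀ A B r s → 4 * A + r + 2 * (4 * B + s) ≡ 4 * (A + 2 * B) + (2 * s + r)
    regroup = solve-∀

bracketExp-evenBits-oddBits : ∀ n → bracketExp (evenBits n) (oddBits n) ≡ suc (2 * n)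
bracketExp-evenBits-oddBits n =
  trans (regroup (g (evenBits n)) (g (oddBits n))) (cong (λ t → suc (2 * t)) (g-evenBits+2g-oddBits n))
  where
  regroup : ∀ A B → 1 + 2 * A + 4 * B ≡ suc (2 * (A + 2 * B))
  regroup = solve-∀

bitsCombination : ℕ → ℕ → ℕ → ℕ
bitsCombination u v n = u * evenBits n + v * oddBits n

bitsCombination-digit : ∀ u v q δ → δ < 4 →
  bitsCombination u v (4 * q + δ) ≡ 2 * bitsCombination u v q + (u * (δ % 2) + v * (δ / 2))
bitsCombination-digit u v q δ δ<4 = begin
  u * evenBits (4 * q + δ) + v * oddBits (4 * q + δ)
    ≡⟨ cong₂ (λ a b → u * a + v * b) (digitSum₁-digit (_% 2) refl q δ δ<4) (digitSum₁-digit (_/ 2) refl q δ δ<4) ⟩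
  u * (2 * evenBits q + δ % 2) + v * (2 * oddBits q + δ / 2)
    ≡⟨ regroup u v (evenBits q) (oddBits q) (δ % 2) (δ / 2) ⟩
  2 * (u * evenBits q + v * oddBits q) + (u * (δ % 2) + v * (δ / 2))
    ∎
  where
  regroup : ∀ u v a b r s → u * (2 * a + r) + v * (2 * b + s) ≡ 2 * (u * a + v * b) + (u * r + v * s)
  regroup = solve-∀

-- Since 2c + 3d = 2(c + d) + d, the strict inequality breaks ties of the first one.
precedesPair-linear : ∀ a b c d → 1 * c + 1 * d ≤ 1 * a + 1 * b → 2 * c + 3 * d < 2 * a + 3 * b → PrecedesPair c d a b
precedesPair-linear a b c d sum≤ key< = lex (m≤n⇒m<n∨m≡n (subst₂ _≤_ (unit c d) (unit a b) sum≤))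
  where
  unit : ∀ x y → 1 * x + 1 * y ≡ x + y
  unit = solve-∀
  split : ∀ x y → 2 * x + 3 * y ≡ 2 * (x + y) + y
  split = solve-∀
  lex : c + d < a + b ⊎ c + d ≡ a + b → PrecedesPair c d a b
  lex (inj₁ sum<) = inj₁ sum<
  lex (inj₂ sum≡) = inj₂ (sum≡ , +-cancelˡ-< (2 * (a + b)) d b
                      (subst (_< 2 * (a + b) + b) (trans (split c d) (cong (λ t → 2 * t + d) sum≡))
                        (subst (2 * c + 3 * d <_) (split a b) key<)))

precedes-linear : ∀ j k → bitsCombination 1 1 j ≤ bitsCombination 1 1 k → bitsCombination 2 3 j < bitsCombination 2 3 k →
                  Precedes (suc (2 * j)) (suc (2 * k))
precedes-linear j k sum≤ key< =
  evenBits k , oddBits k , evenBits j , oddBits j ,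
  sym (bracketExp-evenBits-oddBits k) , sym (bracketExp-evenBits-oddBits j) ,
  precedesPair-linear (evenBits k) (oddBits k) (evenBits j) (oddBits j) sum≤ key<

-- Disjoint binary expansions and Pascal's rule modulo 2

digitsDisjoint : ℕ → ℕ → Bool
digitsDisjoint 0       _       = true
digitsDisjoint (suc _) 0       = true
digitsDisjoint 1       2       = true
digitsDisjoint 2       1       = true
digitsDisjoint _       _       = false

sharedDigit : ℕ → ℕ → ℕ
sharedDigit a b = if digitsDisjoint a b then 0 else 1

-- x and y have no binary digit in common; by Lucas' theorem this says that C(x + y, x) is odd.
disjoint : ℕ → ℕ → Bool
disjoint x y = digitSum sharedDigit x y ≡ᵇ 0

disjoint-digits : ∀ q a p b → a < 4 → b < 4 → disjoint (4 * q + a) (4 * p + b) ≡ digitsDisjoint a b ∧ disjoint q p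
disjoint-digits q a p b a<4 b<4 =
  trans (cong (_≡ᵇ 0) (digitSum-digits sharedDigit refl q a p b a<4 b<4)) (≡ᵇ0-digit (digitSum sharedDigit q p) (digitsDisjoint a b))
  where
  ≡ᵇ0-digit : ∀ n c → ((2 * n + (if c then 0 else 1)) ≡ᵇ 0) ≡ c ∧ (n ≡ᵇ 0)
  ≡ᵇ0-digit zero    true  = refl
  ≡ᵇ0-digit zero    false = refl
  ≡ᵇ0-digit (suc n) true  = refl
  ≡ᵇ0-digit (suc n) false = refl

digitsDisjoint-x0 : ∀ a → digitsDisjoint a 0 ≡ true
digitsDisjoint-x0 zero    = refl
digitsDisjoint-x0 (suc a) = refl

disjoint-x0 : ∀ x → disjoint x 0 ≡ true
disjoint-x0 = base4-induction (λ x → disjoint x 0 ≡ true) refl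
  (λ q δ δ<4 ih → trans (disjoint-digits q δ 0 0 δ<4 (s≤s z≤n)) (cong₂ _∧_ (digitsDisjoint-x0 δ) ih))

disjoint-0y : ∀ y → disjoint 0 y ≡ true
disjoint-0y = base4-induction (λ y → disjoint 0 y ≡ true) refl
  (λ q δ δ<4 ih → trans (disjoint-digits 0 0 q δ (s≤s z≤n) δ<4) ih)

PascalAt : ℕ → ℕ → Set
PascalAt x y = disjoint x y ≡ disjoint (x ∸ 1) y xor disjoint x (y ∸ 1)

digitsDisjoint-pascal : ∀ a b → a < 3 → b < 3 → digitsDisjoint (suc a) (suc b) ≡ digitsDisjoint a (suc b) xor digitsDisjoint (suc a) b
digitsDisjoint-pascal 0 0 _ _ = refl
digitsDisjoint-pascal 0 1 _ _ = refl
digitsDisjoint-pascal 0 2 _ _ = refl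
digitsDisjoint-pascal 1 0 _ _ = refl
digitsDisjoint-pascal 1 1 _ _ = refl
digitsDisjoint-pascal 1 2 _ _ = refl
digitsDisjoint-pascal 2 0 _ _ = refl
digitsDisjoint-pascal 2 1 _ _ = refl
digitsDisjoint-pascal 2 2 _ _ = refl
digitsDisjoint-pascal (suc (suc (suc _))) _ (s≤s (s≤s (s≤s ()))) _
digitsDisjoint-pascal _ (suc (suc (suc _))) _ (s≤s (s≤s (s≤s ())))

digitsDisjoint-x3 : ∀ a → a < 3 → digitsDisjoint (suc a) 3 ≡ false
digitsDisjoint-x3 0 _ = refl
digitsDisjoint-x3 1 _ = refl
digitsDisjoint-x3 2 _ = refl
digitsDisjoint-x3 (suc (suc (suc _))) (s≤s (s≤s (s≤s ())))

digitsDisjoint-3y : ∀ b → b < 3 → digitsDisjoint 3 (suc b) ≡ false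
digitsDisjoint-3y 0 _ = refl
digitsDisjoint-3y 1 _ = refl
digitsDisjoint-3y 2 _ = refl
digitsDisjoint-3y (suc (suc (suc _))) (s≤s (s≤s (s≤s ())))

pascal-noBorrow : ∀ q a p b → a < 3 → b < 3 →
  disjoint (4 * q + suc a) (4 * p + suc b) ≡ disjoint (4 * q + a) (4 * p + suc b) xor disjoint (4 * q + suc a) (4 * p + b)
pascal-noBorrow q a p b a<3 b<3 = begin
  disjoint (4 * q + suc a) (4 * p + suc b)
    ≡⟨ disjoint-digits q (suc a) p (suc b) (s≤s a<3) (s≤s b<3) ⟩
  digitsDisjoint (suc a) (suc b) ∧ disjoint q p
    ≡⟨ cong (_∧ disjoint q p) (digitsDisjoint-pascal a b a<3 b<3) ⟩
  (digitsDisjoint a (suc b) xor digitsDisjoint (suc a) b) ∧ disjoint q p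
    ≡⟨ ∧-distribʳ-xor (disjoint q p) (digitsDisjoint a (suc b)) (digitsDisjoint (suc a) b) ⟩
  (digitsDisjoint a (suc b) ∧ disjoint q p) xor (digitsDisjoint (suc a) b ∧ disjoint q p)
    ≡⟨ sym (cong₂ _xor_ (disjoint-digits q a p (suc b) (m<n⇒m<1+n a<3) (s≤s b<3))
                        (disjoint-digits q (suc a) p b (s≤s a<3) (m<n⇒m<1+n b<3))) ⟩
  disjoint (4 * q + a) (4 * p + suc b) xor disjoint (4 * q + suc a) (4 * p + b)
    ∎

pascal-borrowʳ : ∀ q a p → a < 3 →
  disjoint (4 * q + suc a) (4 * suc p + 0) ≡ disjoint (4 * q + a) (4 * suc p + 0) xor disjoint (4 * q + suc a) (4 * p + 3)
pascal-borrowʳ q a p a<3 = begin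
  disjoint (4 * q + suc a) (4 * suc p + 0)
    ≡⟨ disjoint-digits q (suc a) (suc p) 0 (s≤s a<3) (s≤s z≤n) ⟩
  disjoint q (suc p)
    ≡⟨ sym (xor-identityʳ _) ⟩
  disjoint q (suc p) xor false
    ≡⟨ sym (cong₂ _xor_ (trans (disjoint-digits q a (suc p) 0 (m<n⇒m<1+n a<3) (s≤s z≤n))
                               (cong (_∧ disjoint q (suc p)) (digitsDisjoint-x0 a)))
                        (trans (disjoint-digits q (suc a) p 3 (s≤s a<3) ≤-refl) (cong (_∧ disjoint q p) (digitsDisjoint-x3 a a<3)))) ⟩
  disjoint (4 * q + a) (4 * suc p + 0) xor disjoint (4 * q + suc a) (4 * p + 3)
    ∎

pascal-borrowˡ : ∀ q p b → b < 3 →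
  disjoint (4 * suc q + 0) (4 * p + suc b) ≡ disjoint (4 * q + 3) (4 * p + suc b) xor disjoint (4 * suc q + 0) (4 * p + b)
pascal-borrowˡ q p b b<3 = begin
  disjoint (4 * suc q + 0) (4 * p + suc b)
    ≡⟨ disjoint-digits (suc q) 0 p (suc b) (s≤s z≤n) (s≤s b<3) ⟩
  disjoint (suc q) p
    ≡⟨ sym (cong₂ _xor_ (trans (disjoint-digits q 3 p (suc b) ≤-refl (s≤s b<3)) (cong (_∧ disjoint q p) (digitsDisjoint-3y b b<3)))
                        (disjoint-digits (suc q) 0 p b (s≤s z≤n) (m<n⇒m<1+n b<3))) ⟩
  disjoint (4 * q + 3) (4 * p + suc b) xor disjoint (4 * suc q + 0) (4 * p + b)
    ∎

pascal-borrow² : ∀ q p → PascalAt (suc q) (suc p) →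
  disjoint (4 * suc q + 0) (4 * suc p + 0) ≡ disjoint (4 * q + 3) (4 * suc p + 0) xor disjoint (4 * suc q + 0) (4 * p + 3)
pascal-borrow² q p ih = begin
  disjoint (4 * suc q + 0) (4 * suc p + 0)
    ≡⟨ disjoint-digits (suc q) 0 (suc p) 0 (s≤s z≤n) (s≤s z≤n) ⟩
  disjoint (suc q) (suc p)
    ≡⟨ ih ⟩
  disjoint q (suc p) xor disjoint (suc q) p
    ≡⟨ sym (cong₂ _xor_ (disjoint-digits q 3 (suc p) 0 ≤-refl (s≤s z≤n)) (disjoint-digits (suc q) 0 p 3 (s≤s z≤n) ≤-refl)) ⟩
  disjoint (4 * q + 3) (4 * suc p + 0) xor disjoint (4 * suc q + 0) (4 * p + 3)
    ∎

disjoint-pascal : ∀ x y → 1 ≤ x → 1 ≤ y → PascalAt x y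
disjoint-pascal = base4-induction₂ (λ x y → 1 ≤ x → 1 ≤ y → PascalAt x y) (λ ()) step
  where
  pred-digit : ∀ q a → 4 * q + suc a ∸ 1 ≡ 4 * q + a
  pred-digit q a = cong (_∸ 1) (+-suc (4 * q) a)
  pred-borrow : ∀ q → 4 * suc q + 0 ∸ 1 ≡ 4 * q + 3
  pred-borrow q = cong (_∸ 1) (regroup q)
    where
    regroup : ∀ q → 4 * suc q + 0 ≡ suc (4 * q + 3)
    regroup = solve-∀
  introduce : ∀ x y {x′ y′} → x ∸ 1 ≡ x′ → y ∸ 1 ≡ y′ → disjoint x y ≡ disjoint x′ y xor disjoint x y′ → PascalAt x y
  introduce _ _ refl refl eq = eq
  step : ∀ q a p b → a < 4 → b < 4 → (1 ≤ q → 1 ≤ p → PascalAt q p) →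
         1 ≤ 4 * q + a → 1 ≤ 4 * p + b → PascalAt (4 * q + a) (4 * p + b)
  step q       (suc a) p       (suc b) a<4 b<4 _  _ _ = introduce (4 * q + suc a) (4 * p + suc b) (pred-digit q a) (pred-digit p b)
      (pascal-noBorrow q a p b (≤-pred a<4) (≤-pred b<4))
  step q       (suc a) (suc p) zero    a<4 _   _  _ _ = introduce (4 * q + suc a) (4 * suc p + 0) (pred-digit q a) (pred-borrow p)
      (pascal-borrowʳ q a p (≤-pred a<4))
  step (suc q) zero    p       (suc b) _   b<4 _  _ _ = introduce (4 * suc q + 0) (4 * p + suc b) (pred-borrow q) (pred-digit p b)
      (pascal-borrowˡ q p b (≤-pred b<4))
  step (suc q) zero    (suc p) zero    _   _   ih _ _ = introduce (4 * suc q + 0) (4 * suc p + 0) (pred-borrow q) (pred-borrow p)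
      (pascal-borrow² q p (ih (s≤s z≤n) (s≤s z≤n)))
  step zero    zero    _       _       _   _   _  () _
  step _       _       zero    zero    _   _   _  _  ()

-- The coefficients of β

coeff-⊕ : ∀ p q i → coeff (p ⊕ q) i ≡ coeff p i xor coeff q i
coeff-⊕ []      q       i       = refl
coeff-⊕ (x ∷ p) []      i       = sym (xor-identityʳ _)
coeff-⊕ (x ∷ p) (y ∷ q) zero    = refl
coeff-⊕ (x ∷ p) (y ∷ q) (suc i) = coeff-⊕ p q i

coeff-⊕⁻ : ∀ p q i → coeff (p ⊕ q) i ≡ true → coeff p i ≡ true ⊎ coeff q i ≡ true
coeff-⊕⁻ p q i h with coeff p i | coeff-⊕ p q i
... | true  | _  = inj₁ refl
... | false | eq = inj₂ (trans (sym eq) h)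

coeff-shift : ∀ n p i → coeff (shift n p) (n + i) ≡ coeff p i
coeff-shift zero    p i = refl
coeff-shift (suc n) p i = coeff-shift n p i

coeff-shift⁻ : ∀ n p e → coeff (shift n p) e ≡ true → ∃[ i ] (e ≡ n + i × coeff p i ≡ true)
coeff-shift⁻ zero    p e       h = e , refl , h
coeff-shift⁻ (suc n) p zero    ()
coeff-shift⁻ (suc n) p (suc e) h with coeff-shift⁻ n p e h
... | i , refl , h′ = i , refl , h′

induction₄ : (P : ℕ → Set) → P 0 → P 1 → P 2 → P 3 → (∀ k → P k → P (suc k) → P (4 + k)) → ∀ k → P k
induction₄ P p₀ p₁ p₂ p₃ step k = proj₁ (window k)
  where
  window : ∀ k → P k × P (1 + k) × P (2 + k) × P (3 + k)
  window zero    = p₀ , p₁ , p₂ , p₃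
  window (suc k) with window k
  ... | pk , pk+1 , pk+2 , pk+3 = pk+1 , pk+2 , pk+3 , step k pk pk+1

Splitting : ℕ → ℕ → Set
Splitting k e = ∃₂ λ m r → k ≡ 3 * m + r × e ≡ suc (2 * (m + r))

SupportedAt : ℕ → Set
SupportedAt k = ∀ e → coeff (betaOdd k) e ≡ true → Splitting k e

betaOdd-support : ∀ k → SupportedAt k
betaOdd-support = induction₄ SupportedAt support₀ support₁ support₂ support₃ step
  where
  support₀ : SupportedAt 0
  support₀ 1 _ = 0 , 0 , refl , refl
  support₁ : SupportedAt 1
  support₁ 3 _ = 0 , 1 , refl , refl
  support₂ : SupportedAt 2
  support₂ 5 _ = 0 , 2 , refl , refl
  support₃ : SupportedAt 3
  support₃ 3 _ = 1 , 0 , refl , refl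
  support₃ 7 _ = 0 , 3 , refl , refl
  step : ∀ k → SupportedAt k → SupportedAt (suc k) → SupportedAt (4 + k)
  step k ih₀ ih₁ e h with coeff-⊕⁻ (shift 8 (betaOdd k)) (shift 2 (betaOdd (suc k))) e h
  ... | inj₁ h₈ with coeff-shift⁻ 8 (betaOdd k) e h₈
  ...   | i , refl , hᵢ with ih₀ i hᵢ
  ...     | m , r , refl , refl = m , 4 + r , regroupₖ m r , regroupₑ m r
    where
    regroupₖ : ∀ m r → 4 + (3 * m + r) ≡ 3 * m + (4 + r)
    regroupₖ = solve-∀
    regroupₑ : ∀ m r → 8 + suc (2 * (m + r)) ≡ suc (2 * (m + (4 + r)))
    regroupₑ = solve-∀
  step k ih₀ ih₁ e h | inj₂ h₂ with coeff-shift⁻ 2 (betaOdd (suc k)) e h₂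
  ...   | i , refl , hᵢ with ih₁ i hᵢ
  ...     | m , r , k+1≡ , refl = suc m , r , trans (cong (3 +_) k+1≡) (regroupₖ m r) , regroupₑ m r
    where
    regroupₖ : ∀ m r → 3 + (3 * m + r) ≡ 3 * suc m + r
    regroupₖ = solve-∀
    regroupₑ : ∀ m r → 2 + suc (2 * (m + r)) ≡ suc (2 * (suc m + r))
    regroupₑ = solve-∀

betaOdd-degree : ∀ k j → coeff (betaOdd k) (suc (2 * j)) ≡ true → j ≤ k
betaOdd-degree k j h with betaOdd-support k (suc (2 * j)) h
... | m , r , refl , e≡ = subst (_≤ 3 * m + r) (sym (*-cancelˡ-≡ j (m + r) 2 (suc-injective e≡))) (+-monoˡ-≤ r (m≤n*m m 3))

splitting-unique : ∀ {m r m′ r′} → 3 * m + r ≡ 3 * m′ + r′ → m + r ≡ m′ + r′ → r ≡ r′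
splitting-unique {m} {r} {m′} {r′} k≡ j≡ = +-cancelˡ-≡ m r r′ (trans j≡ (cong (_+ r′) (sym m≡m′)))
  where
  m≡m′ : m ≡ m′
  m≡m′ = *-cancelˡ-≡ m m′ 2 (+-cancelʳ-≡ (m + r) (2 * m) (2 * m′)
           (trans (sym (regroup m r)) (trans k≡ (trans (regroup m′ r′) (cong (2 * m′ +_) (sym j≡))))))
    where
    regroup : ∀ a b → 3 * a + b ≡ 2 * a + (a + b)
    regroup = solve-∀

coeff-shift8 : ∀ p m r → coeff (shift 8 p) (suc (2 * (m + (4 + r)))) ≡ coeff p (suc (2 * (m + r)))
coeff-shift8 p m r = trans (cong (coeff (shift 8 p)) (regroup m r)) (coeff-shift 8 p _)
  where
  regroup : ∀ m r → suc (2 * (m + (4 + r))) ≡ 8 + suc (2 * (m + r))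
  regroup = solve-∀

coeff-shift2 : ∀ p m r → coeff (shift 2 p) (suc (2 * (suc m + r))) ≡ coeff p (suc (2 * (m + r)))
coeff-shift2 p m r = trans (cong (coeff (shift 2 p)) (regroup m r)) (coeff-shift 2 p _)
  where
  regroup : ∀ m r → suc (2 * (suc m + r)) ≡ 2 + suc (2 * (m + r))
  regroup = solve-∀

betaOdd-shift8-absent : ∀ k m r → 4 + k ≡ 3 * m + r → r < 4 → coeff (shift 8 (betaOdd k)) (suc (2 * (m + r))) ≡ false
betaOdd-shift8-absent k m r eq r<4 = ¬-not λ h → absent h
  where
  absent : coeff (shift 8 (betaOdd k)) (suc (2 * (m + r))) ≡ true → ⊥
  absent h with coeff-shift⁻ 8 (betaOdd k) (suc (2 * (m + r))) h
  ... | i , e≡ , hᵢ with betaOdd-support k i hᵢ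
  ... | m′ , r′ , refl , refl = <⇒≱ r<4 (subst (4 ≤_) (sym (splitting-unique k≡ j≡)) (m≤m+n 4 r′))
    where
    k≡ : 3 * m + r ≡ 3 * m′ + (4 + r′)
    k≡ = trans (sym eq) (regroup m′ r′)
      where
      regroup : ∀ m′ r′ → 4 + (3 * m′ + r′) ≡ 3 * m′ + (4 + r′)
      regroup = solve-∀
    j≡ : m + r ≡ m′ + (4 + r′)
    j≡ = *-cancelˡ-≡ (m + r) (m′ + (4 + r′)) 2 (suc-injective (trans e≡ (regroup m′ r′)))
      where
      regroup : ∀ m′ r′ → 8 + suc (2 * (m′ + r′)) ≡ suc (2 * (m′ + (4 + r′)))
      regroup = solve-∀

betaOdd-top-shift2-absent : ∀ k → coeff (shift 2 (betaOdd (suc k))) (suc (2 * (4 + k))) ≡ false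
betaOdd-top-shift2-absent k = trans (coeff-shift2 (betaOdd (suc k)) 0 (3 + k))
  (¬-not λ h → <⇒≱ (s≤s (s≤s (n≤1+n k))) (betaOdd-degree (suc k) (3 + k) h))

CoefficientsAt : ℕ → Set
CoefficientsAt k = ∀ m r → k ≡ 3 * m + r → coeff (betaOdd k) (suc (2 * (m + r))) ≡ disjoint (r / 4) m

module CoefficientsStep (k : ℕ) (ih₀ : CoefficientsAt k) (ih₁ : CoefficientsAt (suc k)) where

  Contributions : ℕ → ℕ → Set
  Contributions m r = coeff (shift 8 (betaOdd k)) (suc (2 * (m + r))) xor coeff (shift 2 (betaOdd (suc k))) (suc (2 * (m + r)))
                      ≡ disjoint (r / 4) m

  decrease-m : ∀ m r → 4 + k ≡ 3 * suc m + r → suc k ≡ 3 * m + r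
  decrease-m m r eq = +-cancelˡ-≡ 3 (suc k) (3 * m + r) (trans eq (regroup m r))
    where
    regroup : ∀ m r → 3 * suc m + r ≡ 3 + (3 * m + r)
    regroup = solve-∀

  decrease-r : ∀ m r → 4 + k ≡ 3 * m + (4 + r) → k ≡ 3 * m + r
  decrease-r m r eq = +-cancelˡ-≡ 4 k (3 * m + r) (trans eq (regroup m r))
    where
    regroup : ∀ m r → 3 * m + (4 + r) ≡ 4 + (3 * m + r)
    regroup = solve-∀

  contributions-m≡0 : Contributions 0 (4 + k)
  contributions-m≡0 = begin
    coeff (shift 8 (betaOdd k)) (suc (2 * (4 + k))) xor coeff (shift 2 (betaOdd (suc k))) (suc (2 * (4 + k)))
      ≡⟨ cong₂ _xor_ (coeff-shift8 (betaOdd k) 0 k) (betaOdd-top-shift2-absent k) ⟩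
    coeff (betaOdd k) (suc (2 * k)) xor false
      ≡⟨ cong (_xor false) (trans (ih₀ 0 k refl) (disjoint-x0 (k / 4))) ⟩
    true
      ≡⟨ sym (disjoint-x0 ((4 + k) / 4)) ⟩
    disjoint ((4 + k) / 4) 0
      ∎

  contributions-r<4 : ∀ m r → r < 4 → 4 + k ≡ 3 * suc m + r → Contributions (suc m) r
  contributions-r<4 m r r<4 eq = begin
    coeff (shift 8 (betaOdd k)) (suc (2 * (suc m + r))) xor coeff (shift 2 (betaOdd (suc k))) (suc (2 * (suc m + r)))
      ≡⟨ cong₂ _xor_ (betaOdd-shift8-absent k (suc m) r eq r<4) (coeff-shift2 (betaOdd (suc k)) m r) ⟩
    coeff (betaOdd (suc k)) (suc (2 * (m + r)))
      ≡⟨ ih₁ m r (decrease-m m r eq) ⟩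
    disjoint (r / 4) m
      ≡⟨ cong (λ x → disjoint x m) r/4≡0 ⟩
    disjoint 0 m
      ≡⟨ trans (disjoint-0y m) (sym (disjoint-0y (suc m))) ⟩
    disjoint 0 (suc m)
      ≡⟨ cong (λ x → disjoint x (suc m)) (sym r/4≡0) ⟩
    disjoint (r / 4) (suc m)
      ∎
    where
    r/4≡0 : r / 4 ≡ 0
    r/4≡0 = m<n⇒m/n≡0 r<4

  contributions-pascal : ∀ m r → 4 + k ≡ 3 * suc m + (4 + r) → Contributions (suc m) (4 + r)
  contributions-pascal m r eq = begin
    coeff (shift 8 (betaOdd k)) (suc (2 * (suc m + (4 + r)))) xor coeff (shift 2 (betaOdd (suc k))) (suc (2 * (suc m + (4 + r))))
      ≡⟨ cong₂ _xor_ (coeff-shift8 (betaOdd k) (suc m) r) (coeff-shift2 (betaOdd (suc k)) m (4 + r)) ⟩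
    coeff (betaOdd k) (suc (2 * (suc m + r))) xor coeff (betaOdd (suc k)) (suc (2 * (m + (4 + r))))
      ≡⟨ cong₂ _xor_ (ih₀ (suc m) r (decrease-r (suc m) r eq)) (ih₁ m (4 + r) (decrease-m m (4 + r) eq)) ⟩
    disjoint (r / 4) (suc m) xor disjoint ((4 + r) / 4) m
      ≡⟨ cong (λ x → disjoint (r / 4) (suc m) xor disjoint x m) [4+r]/4≡1+r/4 ⟩
    disjoint (r / 4) (suc m) xor disjoint (suc (r / 4)) m
      ≡⟨ sym (disjoint-pascal (suc (r / 4)) (suc m) (s≤s z≤n) (s≤s z≤n)) ⟩
    disjoint (suc (r / 4)) (suc m)
      ≡⟨ cong (λ x → disjoint x (suc m)) (sym [4+r]/4≡1+r/4) ⟩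
    disjoint ((4 + r) / 4) (suc m)
      ∎
    where
    [4+r]/4≡1+r/4 : (4 + r) / 4 ≡ suc (r / 4)
    [4+r]/4≡1+r/4 = m/n≡1+[m∸n]/n (m≤m+n 4 r)

  contributions : ∀ m r → 4 + k ≡ 3 * m + r → Contributions m r
  contributions zero    .(4 + k)                  refl = contributions-m≡0
  contributions (suc m) 0                         eq   = contributions-r<4 m 0 (s≤s z≤n) eq
  contributions (suc m) 1                         eq   = contributions-r<4 m 1 (s≤s (s≤s z≤n)) eq
  contributions (suc m) 2                         eq   = contributions-r<4 m 2 (s≤s (s≤s (s≤s z≤n))) eq
  contributions (suc m) 3                         eq   = contributions-r<4 m 3 ≤-refl eq
  contributions (suc m) (suc (suc (suc (suc r)))) eq   = contributions-pascal m r eq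

  coefficientsAt-4+k : CoefficientsAt (4 + k)
  coefficientsAt-4+k m r eq = trans (coeff-⊕ (shift 8 (betaOdd k)) (shift 2 (betaOdd (suc k))) (suc (2 * (m + r)))) (contributions m r eq)

betaOdd-coeff : ∀ k → CoefficientsAt k
betaOdd-coeff = induction₄ CoefficientsAt coefficients₀ coefficients₁ coefficients₂ coefficients₃ CoefficientsStep.coefficientsAt-4+k
  where
  tooLarge : ∀ {k} m r → k ≡ 3 * m + r → k < 3 * m → ⊥
  tooLarge _ _ refl k< = <⇒≱ k< (m≤m+n _ _)
  below : ∀ {k} m → k < 3 → k < 3 * suc m
  below m k<3 = ≤-trans k<3 (*-monoʳ-≤ 3 (s≤s (z≤n {m})))
  coefficients₀ : CoefficientsAt 0
  coefficients₀ zero    0 refl = refl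
  coefficients₀ (suc m) r eq   = ⊥-elim (tooLarge (suc m) r eq (below m (s≤s z≤n)))
  coefficients₁ : CoefficientsAt 1
  coefficients₁ zero    1 refl = refl
  coefficients₁ (suc m) r eq   = ⊥-elim (tooLarge (suc m) r eq (below m (s≤s (s≤s z≤n))))
  coefficients₂ : CoefficientsAt 2
  coefficients₂ zero    2 refl = refl
  coefficients₂ (suc m) r eq   = ⊥-elim (tooLarge (suc m) r eq (below m ≤-refl))
  coefficients₃ : CoefficientsAt 3
  coefficients₃ zero          3 refl = refl
  coefficients₃ 1             0 refl = refl
  coefficients₃ (suc (suc m)) r eq   =
    ⊥-elim (tooLarge (suc (suc m)) r eq (≤-trans (s≤s (s≤s (s≤s (s≤s z≤n)))) (*-monoʳ-≤ 3 (s≤s (s≤s (z≤n {m}))))))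

-- Comparing m + r with 3m + r

allBelow : ℕ → (ℕ → Bool) → Bool
allBelow zero    p = true
allBelow (suc n) p = p n ∧ allBelow n p

allBelow-sound : ∀ n p {i} → T (allBelow n p) → i < n → T (p i)
allBelow-sound (suc n) p h i<1+n with Equivalence.to T-∧ h | m≤n⇒m<n∨m≡n (≤-pred i<1+n)
... | _   , rest | inj₁ i<n  = allBelow-sound n p rest i<n
... | pn  , _    | inj₂ refl = pn

T-not-∨ : ∀ a b → T (not a ∨ b) → T a → T b
T-not-∨ true b h _ = h

sumWithCarry : (a m x ρ c : ℕ) → ℕ
sumWithCarry a m x ρ c = a * m + 4 * x + ρ + c

sumWithCarry-digits : ∀ a q μ p ρ′ ρ c →
  sumWithCarry a (4 * q + μ) (4 * p + ρ′) ρ c ≡ 4 * sumWithCarry a q p ρ′ ((a * μ + ρ + c) / 4) + (a * μ + ρ + c) % 4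
sumWithCarry-digits a q μ p ρ′ ρ c = begin
  a * (4 * q + μ) + 4 * (4 * p + ρ′) + ρ + c                ≡⟨ regroup₁ a q μ p ρ′ ρ c ⟩
  4 * (a * q + 4 * p + ρ′) + t                               ≡⟨ cong (4 * (a * q + 4 * p + ρ′) +_) (m≡d*[m/d]+m%d t 4) ⟩
  4 * (a * q + 4 * p + ρ′) + (4 * (t / 4) + t % 4)            ≡⟨ regroup₂ (a * q) p ρ′ (t / 4) (t % 4) ⟩
  4 * (a * q + 4 * p + ρ′ + t / 4) + t % 4                    ∎
  where
  t = a * μ + ρ + c
  regroup₁ : ∀ a q μ p ρ′ ρ c → a * (4 * q + μ) + 4 * (4 * p + ρ′) + ρ + c ≡ 4 * (a * q + 4 * p + ρ′) + (a * μ + ρ + c)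
  regroup₁ = solve-∀
  regroup₂ : ∀ aq p ρ′ s d → 4 * (aq + 4 * p + ρ′) + (4 * s + d) ≡ 4 * (aq + 4 * p + ρ′ + s) + d
  regroup₂ = solve-∀

-- Reading m and x = r / 4 digit by digit, the automaton remembers the two carries, the digit of r
-- aligned with the current digit of m, and whether m has had a nonzero digit yet.
record State : Set where
  constructor state
  field
    carry₁ carry₃ pending : ℕ
    seen                  : Bool

next : State → ℕ → ℕ → State
next (state c₁ c₃ ρ s) μ ρ′ = state ((1 * μ + ρ + c₁) / 4) ((3 * μ + ρ + c₃) / 4) ρ′ (s ∨ (0 <ᵇ μ))

inRange : State → Bool
inRange (state c₁ c₃ ρ _) = (c₁ <ᵇ 2) ∧ (c₃ <ᵇ 4) ∧ (ρ <ᵇ 4)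

module CarryAutomaton (u v minSlack : ℕ) where

  w : ℕ → ℕ
  w δ = u * (δ % 2) + v * (δ / 2)

  Φ : ℕ → ℕ
  Φ = bitsCombination u v

  Φ-small : ℕ → ℕ
  Φ-small n = 2 * w (n / 4) + w (n % 4)

  admissible : State → Bool
  admissible (state c₁ c₃ ρ true)  = (c₁ ≤ᵇ c₃) ∧ (ρ + c₃ ≤ᵇ 3)
  admissible (state c₁ c₃ ρ false) = (c₁ ≡ᵇ 0) ∧ (c₃ ≡ᵇ 0)

  -- Once m has a nonzero digit the slack is what the pending digits will still contribute;
  -- before that it is the bound sought.
  slack : State → ℕ
  slack (state c₁ c₃ ρ true)  = w (ρ + c₃) ∸ w (ρ + c₁)
  slack (state _  _  _ false) = minSlack

  finalOK : State → Bool
  finalOK s@(state c₁ c₃ ρ sn) = not sn ∨ (Φ-small (ρ + c₁) + slack s ≤ᵇ Φ-small (ρ + c₃))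

  stepOK : State → ℕ → ℕ → Bool
  stepOK s@(state c₁ c₃ ρ _) μ ρ′ =
    not (digitsDisjoint ρ′ μ) ∨
      (inRange (next s μ ρ′) ∧ admissible (next s μ ρ′) ∧
       (w ((1 * μ + ρ + c₁) % 4) + slack s ≤ᵇ w ((3 * μ + ρ + c₃) % 4) + 2 * slack (next s μ ρ′)))

  stateOK : State → Bool
  stateOK s = not (admissible s) ∨ (finalOK s ∧ allBelow 4 (λ μ → allBelow 4 (stepOK s μ)))

  statesOK : ℕ → ℕ → ℕ → Bool
  statesOK c₁ c₃ ρ = stateOK (state c₁ c₃ ρ false) ∧ stateOK (state c₁ c₃ ρ true)

  invariantClosed : Bool
  invariantClosed = allBelow 2 (λ c₁ → allBelow 4 (λ c₃ → allBelow 4 (statesOK c₁ c₃)))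

  Dominates : State → ℕ → ℕ → Set
  Dominates s@(state c₁ c₃ ρ _) m x = Φ (sumWithCarry 1 m x ρ c₁) + slack s ≤ Φ (sumWithCarry 3 m x ρ c₃)

  Invariant : ℕ → ℕ → Set
  Invariant m x = ∀ s → T (inRange s) → T (admissible s) → T (disjoint x m) → T (State.seen s) ⊎ 1 ≤ m → Dominates s m x

  Φ-digit : ∀ q δ → δ < 4 → Φ (4 * q + δ) ≡ 2 * Φ q + w δ
  Φ-digit = bitsCombination-digit u v

  Φ≡Φ-small : ∀ n → n < 16 → Φ n ≡ Φ-small n
  Φ≡Φ-small n n<16 = begin
    Φ n                            ≡⟨ cong Φ (m≡d*[m/d]+m%d n 4) ⟩
    Φ (4 * (n / 4) + n % 4)        ≡⟨ Φ-digit (n / 4) (n % 4) (m%n<n n 4) ⟩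
    2 * Φ (n / 4) + w (n % 4)      ≡⟨ cong (λ t → 2 * t + w (n % 4)) (Φ-digit 0 (n / 4) (m<n*o⇒m/o<n {n} {4} {4} n<16)) ⟩
    2 * (2 * Φ 0 + w (n / 4)) + w (n % 4)
                                   ≡⟨ cong (λ t → 2 * (2 * t + w (n / 4)) + w (n % 4)) (cong₂ _+_ (*-zeroʳ u) (*-zeroʳ v)) ⟩
    Φ-small n                      ∎

  combine : ∀ {L H b b′ dₗ dₕ} → L + b′ ≤ H → dₗ + b ≤ dₕ + 2 * b′ → 2 * L + dₗ + b ≤ 2 * H + dₕ
  combine {L} {H} {b} {b′} {dₗ} {dₕ} L≤H dₗ≤dₕ = +-cancelʳ-≤ (2 * b′) (2 * L + dₗ + b) (2 * H + dₕ)
    (≤-trans (≤-reflexive (regroup₁ L dₗ b b′))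
      (≤-trans (+-mono-≤ (*-monoʳ-≤ 2 L≤H) dₗ≤dₕ) (≤-reflexive (regroup₂ H dₕ b′))))
    where
    regroup₁ : ∀ L dₗ b b′ → 2 * L + dₗ + b + 2 * b′ ≡ 2 * (L + b′) + (dₗ + b)
    regroup₁ = solve-∀
    regroup₂ : ∀ H dₕ b′ → 2 * H + (dₕ + 2 * b′) ≡ 2 * H + dₕ + 2 * b′
    regroup₂ = solve-∀

  Φ-sumWithCarry : ∀ a q μ p ρ′ ρ c →
    Φ (sumWithCarry a (4 * q + μ) (4 * p + ρ′) ρ c) ≡ 2 * Φ (sumWithCarry a q p ρ′ ((a * μ + ρ + c) / 4)) + w ((a * μ + ρ + c) % 4)
  Φ-sumWithCarry a q μ p ρ′ ρ c = trans (cong Φ (sumWithCarry-digits a q μ p ρ′ ρ c))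
    (Φ-digit (sumWithCarry a q p ρ′ ((a * μ + ρ + c) / 4)) ((a * μ + ρ + c) % 4) (m%n<n (a * μ + ρ + c) 4))

  seen-next : ∀ sn μ q → T sn ⊎ 1 ≤ 4 * q + μ → T (sn ∨ (0 <ᵇ μ)) ⊎ 1 ≤ q
  seen-next true  μ       q       _        = inj₁ _
  seen-next false (suc μ) q       _        = inj₁ _
  seen-next false zero    (suc q) _        = inj₂ (s≤s z≤n)
  seen-next false zero    zero    (inj₂ ())

  inRange-bounds : ∀ c₁ c₃ ρ sn → T (inRange (state c₁ c₃ ρ sn)) → c₁ < 2 × c₃ < 4 × ρ < 4
  inRange-bounds c₁ c₃ ρ sn h with Equivalence.to T-∧ h
  ... | h₁ , h₂ with Equivalence.to T-∧ h₂
  ... | h₃ , h₄ = <ᵇ⇒< c₁ 2 h₁ , <ᵇ⇒< c₃ 4 h₃ , <ᵇ⇒< ρ 4 h₄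

  module _ (ok : T invariantClosed) where

    stateOK-inRange : ∀ s → T (inRange s) → T (stateOK s)
    stateOK-inRange (state c₁ c₃ ρ sn) inR with inRange-bounds c₁ c₃ ρ sn inR
    ... | c₁<2 , c₃<4 , ρ<4 = pick sn
          (allBelow-sound 4 (statesOK c₁ c₃)
            (allBelow-sound 4 (λ c₃ → allBelow 4 (statesOK c₁ c₃))
              (allBelow-sound 2 (λ c₁ → allBelow 4 (λ c₃ → allBelow 4 (statesOK c₁ c₃))) ok c₁<2) c₃<4) ρ<4)
      where
      pick : ∀ sn → T (statesOK c₁ c₃ ρ) → T (stateOK (state c₁ c₃ ρ sn))
      pick false h = proj₁ (Equivalence.to T-∧ h)
      pick true  h = proj₂ (Equivalence.to T-∧ h)

    stateOK-admissible : ∀ s → T (inRange s) → T (admissible s) →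
                         T (finalOK s) × (∀ μ ρ′ → μ < 4 → ρ′ < 4 → T (stepOK s μ ρ′))
    stateOK-admissible s inR adm with Equivalence.to T-∧ (T-not-∨ _ _ (stateOK-inRange s inR) adm)
    ... | final , steps = final , λ μ ρ′ μ<4 ρ′<4 →
      allBelow-sound 4 (stepOK s μ) (allBelow-sound 4 (λ μ → allBelow 4 (stepOK s μ)) steps μ<4) ρ′<4

    invariant : ∀ m x → Invariant m x
    invariant = base4-induction₂ Invariant final step
      where
      final : Invariant 0 0
      final s@(state c₁ c₃ ρ true) inR adm _ _ with inRange-bounds c₁ c₃ ρ true inR
      ... | c₁<2 , c₃<4 , ρ<4 =
        subst₂ (λ l h → l + slack s ≤ h)
          (sym (Φ≡Φ-small (ρ + c₁) (small (≤-trans c₁<2 (m≤m+n 2 2))))) (sym (Φ≡Φ-small (ρ + c₃) (small c₃<4)))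
          (≤ᵇ⇒≤ _ _ (proj₁ (stateOK-admissible s inR adm)))
        where
        small : ∀ {c} → c < 4 → ρ + c < 16
        small c<4 = ≤-trans (+-mono-≤ ρ<4 (<⇒≤ c<4)) (m≤m+n 8 8)
      final (state c₁ c₃ ρ false) _ _ _ (inj₁ ())
      final (state c₁ c₃ ρ false) _ _ _ (inj₂ ())
      step : ∀ q μ p ρ′ → μ < 4 → ρ′ < 4 → Invariant q p → Invariant (4 * q + μ) (4 * p + ρ′)
      step q μ p ρ′ μ<4 ρ′<4 ih s@(state c₁ c₃ ρ sn) inR adm disj seen
        with Equivalence.to T-∧ (subst T (disjoint-digits p ρ′ q μ ρ′<4 μ<4) disj)
      ... | digitsOK , disj′
        with Equivalence.to T-∧ (T-not-∨ _ _ (proj₂ (stateOK-admissible s inR adm) μ ρ′ μ<4 ρ′<4) digitsOK)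
      ... | inR′ , h
        with Equivalence.to T-∧ h
      ... | adm′ , digitIneq =
        subst₂ (λ l h → l + slack s ≤ h) (sym (Φ-sumWithCarry 1 q μ p ρ′ ρ c₁)) (sym (Φ-sumWithCarry 3 q μ p ρ′ ρ c₃))
          (combine {Φ (sumWithCarry 1 q p ρ′ ((1 * μ + ρ + c₁) / 4))} {Φ (sumWithCarry 3 q p ρ′ ((3 * μ + ρ + c₃) / 4))}
            (ih (next s μ ρ′) inR′ adm′ disj′ (seen-next sn μ q seen)) (≤ᵇ⇒≤ _ _ digitIneq))

    Φ[m+r]+minSlack≤Φ[3m+r] : ∀ m r → 1 ≤ m → T (disjoint (r / 4) m) → Φ (m + r) + minSlack ≤ Φ (3 * m + r)
    Φ[m+r]+minSlack≤Φ[3m+r] m r 1≤m disj =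
      subst₂ (λ l h → Φ l + minSlack ≤ Φ h) (trans (split 1 m r) (cong (_+ r) (*-identityˡ m))) (split 3 m r)
        (invariant m (r / 4) (state 0 0 (r % 4) false) (<⇒<ᵇ (m%n<n r 4)) _ disj (inj₂ 1≤m))
      where
      split : ∀ a m r → sumWithCarry a m (r / 4) (r % 4) 0 ≡ a * m + r
      split a m r = trans (regroup (a * m) (4 * (r / 4)) (r % 4)) (cong (a * m +_) (sym (m≡d*[m/d]+m%d r 4)))
        where
        regroup : ∀ x y z → x + y + z + 0 ≡ x + (y + z)
        regroup = solve-∀

module SumBound = CarryAutomaton 1 1 0
module KeyBound = CarryAutomaton 2 3 1

sumBound-closed : T SumBound.invariantClosed
sumBound-closed = tt

keyBound-closed : T KeyBound.invariantClosed
keyBound-closed = tt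

precedes-3m+r : ∀ m r → T (disjoint (r / 4) m) → 1 ≤ m → Precedes (suc (2 * (m + r))) (suc (2 * (3 * m + r)))
precedes-3m+r m r disj 1≤m = precedes-linear (m + r) (3 * m + r)
  (subst (_≤ bitsCombination 1 1 (3 * m + r)) (+-identityʳ _) (SumBound.Φ[m+r]+minSlack≤Φ[3m+r] sumBound-closed m r 1≤m disj))
  (subst (_≤ bitsCombination 2 3 (3 * m + r)) (+-comm _ 1) (KeyBound.Φ[m+r]+minSlack≤Φ[3m+r] keyBound-closed m r 1≤m disj))

corollary3p4 : (k : ℕ) →
    (coeff (betaOdd k) (suc (2 * k)) ≡ true) ×
    ((e : ℕ) → coeff (betaOdd k) e ≡ true → (e ≡ suc (2 * k)) ⊎ Precedes e (suc (2 * k)))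
corollary3p4 k = trans (betaOdd-coeff k 0 k refl) (disjoint-x0 (k / 4)) , lower
  where
  lower : (e : ℕ) → coeff (betaOdd k) e ≡ true → (e ≡ suc (2 * k)) ⊎ Precedes e (suc (2 * k))
  lower e h with betaOdd-support k e h
  ... | zero  , r , refl , refl = inj₁ refl
  ... | suc m , r , refl , refl =
    inj₂ (precedes-3m+r (suc m) r (Equivalence.from T-≡ (trans (sym (betaOdd-coeff _ (suc m) r refl)) h)) (s≤s z≤n))
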